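{- For all sequences of bins $\sigma$ and all integers $s',\ell'\ge 0$, if $2k=s'+2\ell'$, then $$R(\sigma,s',\ell')\le \mathrm{OPT}(\sigma,0,k)+(s'+\ell'-k-1)L+M.$$
   Context: Restricted Grid Scheduling setting: $S>1$ is an integer, $L=2S-1$, $M=4S-3$; bins have integer sizes in $[S,M]$ and $\sigma$ contains enough bins for all items to be packed. A packing is valid if each empty bin is smaller than every item packed in a later bin; its cost is the sum of sizes of bins receiving at least one item. $\mathrm{OPT}(\sigma,s,\ell)$ is the minimum cost of a valid packing of $s$ items of size $S$ and $\ell$ items of size $L$ into $\sigma$. A bin is wasteful if its empty space is at least as large as some item packed in a later bin; a packing is thrifty if no bin is wasteful. A partial packing is reasonable if every bin $b$ it packs contains: one item of size $S$ if $\mathrm{size}(b)\in[S,L-1]$; one item of size $L$ if $\mathrm{size}(b)=L$; two items of size $S$ or one of size $L$ if $\mathrm{size}(b)\in[L+1,L+S-1]$; one item of size $S$ and one of size $L$ if $\mathrm{size}(b)=L+S$; three items of size $S$ or one of size $S$ and one of size $L$ if $\mathrm{size}(b)\in[L+S+1,2L-1]$. The key bin of a packing is the first bin after which no items of size $L$ remain or at most two items of size $S$ remain; the front is the partial packing agreeing with the packing up to and including the key bin and empty afterwards. A packing is reasonable if it is thrifty and its front is reasonable. $R(\sigma,s,\ell)$ is the maximum cost of any reasonable packing of $s$ items of size $S$ and $\ell$ items of size $L$ into $\sigma$. -}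

module Defs where

open import Data.Nat using (ℕ; zero; suc; _+_; _*_; _∸_; _≤_; _<_; _<ᵇ_)
open import Data.Fin using (Fin; toℕ) renaming (zero to fzero; suc to fsuc)
open import Data.Bool using (if_then_else_)
open import Data.Product using (_×_; ∃-syntax)
open import Data.Sum using (_⊎_)
open import Relation.Binary.PropositionalEquality using (_≡_)
open import Relation.Nullary using (¬_)

L : ℕ → ℕ
L S = 2 * S ∸ 1

M : ℕ → ℕ
M S = 4 * S ∸ 3

Σ : ∀ {n} → (Fin n → ℕ) → ℕ
Σ {zero}  f = 0
Σ {suc n} f = f fzero + Σ (λ i → f (fsuc i))

after : ∀ {n} → Fin n → (Fin n → ℕ) → ℕ
after i f = Σ (λ j → if toℕ i <ᵇ toℕ j then f j else 0)

BinSizesOK : ℕ → ∀ {n} → (Fin n → ℕ) → Set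
BinSizesOK S σ = ∀ i → S ≤ σ i × σ i ≤ M S

-- A packing of s items of size S and ℓ items of size L into σ:
-- bin i receives (a i) items of size S and (b i) items of size L.
record Packing (S : ℕ) {n : ℕ} (σ : Fin n → ℕ) (s ℓ : ℕ) : Set where
  field
    a      : Fin n → ℕ
    b      : Fin n → ℕ
    fits   : ∀ i → a i * S + b i * L S ≤ σ i
    countS : Σ a ≡ s
    countL : Σ b ≡ ℓ
open Packing public

module _ {S n : ℕ} {σ : Fin n → ℕ} {s ℓ : ℕ} (p : Packing S σ s ℓ) where

  load : Fin n → ℕ
  load i = a p i * S + b p i * L S

  space : Fin n → ℕ
  space i = σ i ∸ load i

  EmptyBin : Fin n → Set
  EmptyBin i = a p i ≡ 0 × b p i ≡ 0

  Nonempty : Fin n → Set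
  Nonempty i = ¬ EmptyBin i

  HasItemOfSize : Fin n → ℕ → Set
  HasItemOfSize j x = (x ≡ S × 0 < a p j) ⊎ (x ≡ L S × 0 < b p j)

  Valid : Set
  Valid = ∀ i j x → EmptyBin i → toℕ i < toℕ j → HasItemOfSize j x → σ i < x

  Wasteful : Fin n → Set
  Wasteful i = ∃[ j ] ∃[ x ] (toℕ i < toℕ j × HasItemOfSize j x × x ≤ space i)

  Thrifty : Set
  Thrifty = ∀ i → ¬ Wasteful i

  cost : ℕ
  cost = Σ (λ i → if (0 <ᵇ (a p i + b p i)) then σ i else 0)

  KeyCond : Fin n → Set
  KeyCond i = after i (b p) ≡ 0 ⊎ after i (a p) ≤ 2

  IsKeyBin : Fin n → Set
  IsKeyBin i = KeyCond i × (∀ j → toℕ j < toℕ i → ¬ KeyCond j)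

data ReasonableBin (S : ℕ) (z x y : ℕ) : Set where
  r1  : S ≤ z → z ≤ L S ∸ 1 → x ≡ 1 → y ≡ 0 → ReasonableBin S z x y
  r2  : z ≡ L S → x ≡ 0 → y ≡ 1 → ReasonableBin S z x y
  r3a : L S + 1 ≤ z → z ≤ L S + S ∸ 1 → x ≡ 2 → y ≡ 0 → ReasonableBin S z x y
  r3b : L S + 1 ≤ z → z ≤ L S + S ∸ 1 → x ≡ 0 → y ≡ 1 → ReasonableBin S z x y
  r4  : z ≡ L S + S → x ≡ 1 → y ≡ 1 → ReasonableBin S z x y
  r5a : L S + S + 1 ≤ z → z ≤ 2 * L S ∸ 1 → x ≡ 3 → y ≡ 0 → ReasonableBin S z x y
  r5b : L S + S + 1 ≤ z → z ≤ 2 * L S ∸ 1 → x ≡ 1 → y ≡ 1 → ReasonableBin S z x y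

module _ {S n : ℕ} {σ : Fin n → ℕ} {s ℓ : ℕ} (p : Packing S σ s ℓ) where

  ReasonableFront : Set
  ReasonableFront = ∀ k → IsKeyBin p k → ∀ i → toℕ i ≤ toℕ k → Nonempty p i →
                    ReasonableBin S (σ i) (a p i) (b p i)

  Reasonable : Set
  Reasonable = Thrifty p × ReasonableFront

-- Compare P with the packing Q of k items of size L.  Bin by bin, the charge of P plus L for
-- each item of Q is at most the charge of Q plus L for each item of P, except in an
-- overcharged bin: one larger than L in which P puts a single item and Q nothing.  There the
-- shortfall is σ − L ≤ M − L, so it suffices that there are no two overcharged bins i < j.
-- Weigh S-items 1 and L-items 2; both packings weigh 2k, so the weight P puts into i and j
-- (at least 3, else bin i would be wasteful) is made up by deficit bins, where Q has an
-- L-item and P less weight.  By validity of Q and thriftiness of P a deficit bin lies before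
-- i, has size at least L and holds a single S-item of P; such a bin is not reasonable, so
-- it lies after the key bin.  Hence at least three S-items remain after the key bin, so no
-- L-item does, and then i and j both hold single S-items, making bin i wasteful.

module Submission where

open import Defs
open import Data.Nat using (ℕ; zero; suc; _+_; _*_; _∸_; _≤_; _<_; _⊓_; z≤n; s≤s; _<ᵇ_; _≟_; _≤?_; _<?_)
open import Data.Nat.Properties
open import Data.Nat.Tactic.RingSolver using (solve-∀)
open import Algebra.Properties.CommutativeSemigroup +-commutativeSemigroup using (interchange)
open import Data.Fin using (Fin; toℕ; fromℕ) renaming (zero to fzero; suc to fsuc)
open import Data.Fin.Properties using (toℕ-fromℕ; toℕ≤pred[n]; toℕ-injective)
open import Data.Bool using (true; false; T; if_then_else_)
open import Data.Product using (_×_; _,_; proj₂; Σ-syntax)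
open import Data.Sum using (_⊎_; inj₁; inj₂)
open import Data.Empty using (⊥; ⊥-elim)
open import Data.Unit using (tt)
open import Function using (_∘_)
open import Relation.Nullary using (¬_; Dec; yes; no)
open import Relation.Nullary.Decidable using (_×-dec_; _⊎-dec_)
open import Relation.Binary.Definitions using (tri<; tri≈; tri>)
open import Relation.Binary.PropositionalEquality

≡suc⇒0< : ∀ {x y} → x ≡ suc y → 0 < x
≡suc⇒0< refl = s≤s z≤n

Σ-cong : ∀ {n} {f g : Fin n → ℕ} → (∀ i → f i ≡ g i) → Σ f ≡ Σ g
Σ-cong {zero}  f≗g = refl
Σ-cong {suc n} f≗g = cong₂ _+_ (f≗g fzero) (Σ-cong (f≗g ∘ fsuc))

Σ-mono : ∀ {n} {f g : Fin n → ℕ} → (∀ i → f i ≤ g i) → Σ f ≤ Σ g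
Σ-mono {zero}  f≤g = z≤n
Σ-mono {suc n} f≤g = +-mono-≤ (f≤g fzero) (Σ-mono (f≤g ∘ fsuc))

Σ-zero : ∀ {n} {f : Fin n → ℕ} → (∀ i → f i ≡ 0) → Σ f ≡ 0
Σ-zero {zero}  f≗0 = refl
Σ-zero {suc n} f≗0 = cong₂ _+_ (f≗0 fzero) (Σ-zero (f≗0 ∘ fsuc))

Σ-+ : ∀ {n} (f g : Fin n → ℕ) → Σ (λ i → f i + g i) ≡ Σ f + Σ g
Σ-+ {zero}  f g = refl
Σ-+ {suc n} f g =
  trans (cong (f fzero + g fzero +_) (Σ-+ (f ∘ fsuc) (g ∘ fsuc)))
        (interchange (f fzero) (g fzero) (Σ (f ∘ fsuc)) (Σ (g ∘ fsuc)))

Σ-*ʳ : ∀ {n} (f : Fin n → ℕ) c → Σ (λ i → f i * c) ≡ Σ f * c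
Σ-*ʳ {zero}  f c = refl
Σ-*ʳ {suc n} f c =
  trans (cong (f fzero * c +_) (Σ-*ʳ (f ∘ fsuc) c)) (sym (*-distribʳ-+ c (f fzero) _))

≤Σ : ∀ {n} (f : Fin n → ℕ) i → f i ≤ Σ f
≤Σ f fzero    = m≤m+n _ _
≤Σ f (fsuc i) = ≤-trans (≤Σ (f ∘ fsuc) i) (m≤n+m _ (f fzero))

Σ-pair : ∀ {n} (f : Fin n → ℕ) {i j} → toℕ i < toℕ j → f i + f j ≤ Σ f
Σ-pair f {fzero}  {fsuc j} _         = +-monoʳ-≤ (f fzero) (≤Σ (f ∘ fsuc) j)
Σ-pair f {fsuc i} {fsuc j} (s≤s i<j) = ≤-trans (Σ-pair (f ∘ fsuc) i<j) (m≤n+m _ (f fzero))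

Σ>0⇒∃>0 : ∀ {n} (f : Fin n → ℕ) → 0 < Σ f → Σ[ i ∈ Fin n ] 0 < f i
Σ>0⇒∃>0 {suc n} f 0<Σf with f fzero in eq
... | suc _ = fzero , ≡suc⇒0< eq
... | zero  with i , 0<fi ← Σ>0⇒∃>0 (f ∘ fsuc) 0<Σf = fsuc i , 0<fi

Σ≤-support≤1 : ∀ {n} {f : Fin n → ℕ} {c} → (∀ i → f i ≤ c) →
  (∀ {i j} → toℕ i < toℕ j → 0 < f i → 0 < f j → ⊥) → Σ f ≤ c
Σ≤-support≤1 {zero}  _   _        = z≤n
Σ≤-support≤1 {suc n} {f} {c} f≤c disjoint with f fzero in eq
... | zero  = Σ≤-support≤1 (f≤c ∘ fsuc) (λ i<j → disjoint (s≤s i<j))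
... | suc m = subst (λ r → suc m + r ≤ c) (sym rest≡0)
                (subst (_≤ c) (trans eq (sym (+-identityʳ (suc m)))) (f≤c fzero))
  where
    rest≡0 : Σ (f ∘ fsuc) ≡ 0
    rest≡0 = Σ-zero λ i → n≤0⇒n≡0 (≮⇒≥ (disjoint {fzero} {fsuc i} (s≤s z≤n) (≡suc⇒0< eq)))

Σ-∸-balance : ∀ {n} (f g : Fin n → ℕ) → Σ f ≡ Σ g →
  Σ (λ i → f i ∸ g i) ≡ Σ (λ i → g i ∸ f i)
Σ-∸-balance f g Σf≡Σg = +-cancelˡ-≡ (Σ common) _ _ (begin
    Σ common + Σ (λ i → f i ∸ g i)  ≡⟨ Σ-+ common _ ⟨
    Σ (λ i → common i + (f i ∸ g i)) ≡⟨ Σ-cong (λ i → trans (cong (_+ (f i ∸ g i)) (⊓-comm (f i) (g i))) (m⊓n+n∸m≡n (g i) (f i))) ⟩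
    Σ f                              ≡⟨ Σf≡Σg ⟩
    Σ g                              ≡⟨ Σ-cong (λ i → m⊓n+n∸m≡n (f i) (g i)) ⟨
    Σ (λ i → common i + (g i ∸ f i)) ≡⟨ Σ-+ common _ ⟩
    Σ common + Σ (λ i → g i ∸ f i)  ∎)
  where
    open ≡-Reasoning
    common : Fin _ → ℕ
    common i = f i ⊓ g i

if-T : ∀ {b} {x : ℕ} → T b → (if b then x else 0) ≡ x
if-T {true} _ = refl

if-¬T : ∀ {b} {x : ℕ} → ¬ T b → (if b then x else 0) ≡ 0
if-¬T {true}  ¬t = ⊥-elim (¬t tt)
if-¬T {false} _  = refl

module _ {n} {i : Fin n} {f : Fin n → ℕ} where

  ≤after : ∀ {j} → toℕ i < toℕ j → f j ≤ after i f
  ≤after {j} i<j = subst (_≤ after i f) (if-T (<⇒<ᵇ i<j)) (≤Σ _ j)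

  after≡0 : (∀ j → toℕ i < toℕ j → f j ≡ 0) → after i f ≡ 0
  after≡0 f≗0 = Σ-zero λ j → term≡0 j (toℕ i <? toℕ j)
    where
      term≡0 : ∀ j → Dec (toℕ i < toℕ j) → (if toℕ i <ᵇ toℕ j then f j else 0) ≡ 0
      term≡0 j (yes i<j) = trans (if-T (<⇒<ᵇ i<j)) (f≗0 j i<j)
      term≡0 j (no i≮j)  = if-¬T (i≮j ∘ <ᵇ⇒< (toℕ i) (toℕ j))

  Σ≤after : {g : Fin n → ℕ} → (∀ j → 0 < g j → toℕ i < toℕ j × g j ≤ f j) → Σ g ≤ after i f
  Σ≤after {g} bound = Σ-mono termwise
    where
      termwise : ∀ j → g j ≤ (if toℕ i <ᵇ toℕ j then f j else 0)
      termwise j with g j in eq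
      ... | zero  = z≤n
      ... | suc m with i<j , g≤f ← bound j (≡suc⇒0< eq) =
        subst₂ _≤_ eq (sym (if-T (<⇒<ᵇ i<j))) g≤f

∃-least : ∀ {n} (P : Fin n → Set) → (∀ i → Dec (P i)) → ∀ {i} → P i →
  Σ[ k ∈ Fin n ] (P k × (∀ j → toℕ j < toℕ k → ¬ P j))
∃-least {suc n} P P? {i} Pi with P? fzero | i
... | yes P0 | _      = fzero , P0 , λ _ ()
... | no ¬P0 | fzero  = ⊥-elim (¬P0 Pi)
... | no ¬P0 | fsuc i with k , Pk , least ← ∃-least (P ∘ fsuc) (P? ∘ fsuc) Pi =
  fsuc k , Pk , λ { fzero _ → ¬P0 ; (fsuc j) (s≤s j<k) → least j j<k }

keyBin : ∀ {S n s ℓ} {σ : Fin n → ℕ} (p : Packing S σ s ℓ) → Fin n → Σ[ κ ∈ Fin n ] IsKeyBin p κ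
keyBin {n = suc m} p _ = ∃-least (KeyCond p) keyCond? {fromℕ m} lastCond
  where
    keyCond? : ∀ i → Dec (KeyCond p i)
    keyCond? i = (after i (b p) ≟ 0) ⊎-dec (after i (a p) ≤? 2)
    lastCond : KeyCond p (fromℕ m)
    lastCond = inj₁ (after≡0 {i = fromℕ m} {f = b p} λ j last<j →
      ⊥-elim (<⇒≱ (subst (_< toℕ j) (toℕ-fromℕ m) last<j) (toℕ≤pred[n] j)))

L-suc : ∀ s → L (suc s) ≡ suc (2 * s)
L-suc s = cong (_∸ 1) (*-suc 2 s)

M-suc : ∀ s → M (suc s) ≡ suc (4 * s)
M-suc s = cong (_∸ 3) (*-suc 4 s)

S≤L : ∀ {S} → 1 ≤ S → S ≤ L S
S≤L {suc s} _ = subst (suc s ≤_) (sym (L-suc s)) (s≤s (m≤n*m s 2))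

L≤M : ∀ S → L S ≤ M S
L≤M zero    = z≤n
L≤M (suc s) = subst₂ _≤_ (sym (L-suc s)) (sym (M-suc s)) (s≤s (*-monoˡ-≤ s (s≤s (s≤s (z≤n {2})))))

M<2L : ∀ {S} → 1 ≤ S → M S < 2 * L S
M<2L {suc s} _ = subst₂ _<_ (sym (M-suc s)) (cong (2 *_) (sym (L-suc s))) (≤-reflexive (2+4s s))
  where
    2+4s : ∀ s → suc (suc (4 * s)) ≡ 2 * suc (2 * s)
    2+4s = solve-∀

L<⇒S≤∸S : ∀ {S z} → L S < z → S ≤ z ∸ S
L<⇒S≤∸S {zero}      _   = z≤n
L<⇒S≤∸S {suc s} {z} L<z = m+n≤o⇒m≤o∸n (suc s) (subst (_≤ z) (2+2s s) (subst (_< z) (L-suc s) L<z))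
  where
    2+2s : ∀ s → suc (suc (2 * s)) ≡ suc s + suc s
    2+2s = solve-∀

charged : ℕ → ℕ → ℕ
charged x z = if 0 <ᵇ x then z else 0

-- A bin of size z holding x items of P and q items of size ℓ of Q; e covers the overcharge.
charge-exchange : ∀ {ℓ m} x q z e → m < 2 * ℓ → q ≤ 1 → q * ℓ ≤ z → z ≤ m →
  (x ≡ 1 → q ≡ 0 → z ≤ ℓ + e) → charged x z + q * ℓ ≤ charged q z + x * ℓ + e
charge-exchange zero          zero    z e _    _ _ _   _     = z≤n
charge-exchange {ℓ} 1         zero    z e _    _ _ _   lone  =
  subst₂ _≤_ (sym (+-identityʳ z)) (cong (_+ e) (sym (+-identityʳ ℓ))) (lone refl refl)
charge-exchange {ℓ} (suc (suc x)) zero z e m<2ℓ _ _ z≤m _  =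
  subst (_≤ _) (sym (+-identityʳ z))
    (≤-trans (<⇒≤ (≤-trans (s≤s z≤m) m<2ℓ)) (≤-trans (*-monoˡ-≤ ℓ (s≤s (s≤s (z≤n {x})))) (m≤m+n _ e)))
charge-exchange zero          1       z e _    _ ℓ≤z _ _     = ≤-trans ℓ≤z (≤-trans (m≤m+n z 0) (m≤m+n _ e))
charge-exchange {ℓ} (suc x)   1       z e _    _ _ _   _     =
  ≤-trans (+-monoʳ-≤ z (+-monoʳ-≤ ℓ (z≤n {x * ℓ}))) (m≤m+n _ e)
charge-exchange _ (suc (suc _)) _ _ _ (s≤s ()) _ _ _

space-empty : ∀ {S n s ℓ} {σ : Fin n → ℕ} (p : Packing S σ s ℓ) {i} → EmptyBin p i → space p i ≡ σ i
space-empty {S} {σ = σ} p {i} (a≡0 , b≡0) = cong (σ i ∸_) (cong₂ (λ x y → x * S + y * L S) a≡0 b≡0)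

single-item : ∀ x y → x + y ≡ 1 → (x ≡ 1 × y ≡ 0) ⊎ (x ≡ 0 × y ≡ 1)
single-item 1    0 _ = inj₁ (refl , refl)
single-item 0    1 _ = inj₂ (refl , refl)
single-item 0    (suc (suc _)) ()
single-item 1    (suc _)       ()
single-item (suc (suc _)) _    ()

lone-S-bin<L : ∀ {S z} → 1 ≤ S → ReasonableBin S z 1 0 → z < L S
lone-S-bin<L {z = z} 1≤S (r1 _ z≤L∸1 _ _) = subst (z <_) (m+[n∸m]≡n (≤-trans 1≤S (S≤L 1≤S))) (s≤s z≤L∸1)
lone-S-bin<L _ (r2 _ () _)
lone-S-bin<L _ (r3a _ _ () _)
lone-S-bin<L _ (r3b _ _ () _)
lone-S-bin<L _ (r4 _ _ ())
lone-S-bin<L _ (r5a _ _ () _)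
lone-S-bin<L _ (r5b _ _ _ ())

lone-S-weight : ∀ x y → x + y * 2 < 2 → ¬ (x ≡ 0 × y ≡ 0) → x ≡ 1 × y ≡ 0
lone-S-weight 0 0 _ nonempty = ⊥-elim (nonempty (refl , refl))
lone-S-weight 1 0 _ _ = refl , refl
lone-S-weight (suc (suc _)) _       (s≤s (s≤s ())) _
lone-S-weight 0             (suc _) (s≤s (s≤s ())) _
lone-S-weight 1             (suc _) (s≤s (s≤s ())) _

module Accounting {S n} {σ : Fin n → ℕ} (1≤S : 1 ≤ S) (sizes : BinSizesOK S σ)
                  {s' ℓ' k} (P : Packing S σ s' ℓ') (Q : Packing S σ 0 k) where

  items : Fin n → ℕ
  items i = a P i + b P i

  Overcharged : Fin n → Set
  Overcharged i = items i ≡ 1 × b Q i ≡ 0 × L S < σ i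

  overcharged? : ∀ i → Dec (Overcharged i)
  overcharged? i = (items i ≟ 1) ×-dec ((b Q i ≟ 0) ×-dec (L S <? σ i))

  excess : Fin n → ℕ
  excess i with overcharged? i
  ... | yes _ = σ i ∸ L S
  ... | no  _ = 0

  excess>0⇒overcharged : ∀ {i} → 0 < excess i → Overcharged i
  excess>0⇒overcharged {i} 0<e with overcharged? i
  ... | yes oi = oi

  excess≤M∸L : ∀ i → excess i ≤ M S ∸ L S
  excess≤M∸L i with overcharged? i
  ... | yes _ = ∸-monoˡ-≤ (L S) (proj₂ (sizes i))
  ... | no  _ = z≤n

  lone-item≤L+excess : ∀ i → items i ≡ 1 → b Q i ≡ 0 → σ i ≤ L S + excess i
  lone-item≤L+excess i lone noL with overcharged? i
  ... | yes _  = m≤n+m∸n (σ i) (L S)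
  ... | no ¬oi = subst (σ i ≤_) (sym (+-identityʳ (L S))) (≮⇒≥ λ L<σ → ¬oi (lone , noL , L<σ))

  Q-noS : ∀ i → a Q i ≡ 0
  Q-noS i = n≤0⇒n≡0 (subst (a Q i ≤_) (countS Q) (≤Σ (a Q) i))

  L*Q≤σ : ∀ i → b Q i * L S ≤ σ i
  L*Q≤σ i = ≤-trans (m≤n+m _ (a Q i * S)) (fits Q i)

  Q-L⇒L≤σ : ∀ {i} → b Q i ≡ 1 → L S ≤ σ i
  Q-L⇒L≤σ {i} bQ≡1 = subst (_≤ σ i) (*-identityˡ (L S)) (subst (λ y → y * L S ≤ σ i) bQ≡1 (L*Q≤σ i))

  Q-L≤1 : ∀ i → b Q i ≤ 1
  Q-L≤1 i = ≮⇒≥ λ 1<bQ →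
    <⇒≱ (M<2L 1≤S) (≤-trans (*-monoˡ-≤ (L S) 1<bQ) (≤-trans (L*Q≤σ i) (proj₂ (sizes i))))

  charge-exchange-bin : ∀ i →
    charged (items i) (σ i) + b Q i * L S ≤ charged (a Q i + b Q i) (σ i) + items i * L S + excess i
  charge-exchange-bin i rewrite Q-noS i =
    charge-exchange (items i) (b Q i) (σ i) (excess i) (M<2L 1≤S) (Q-L≤1 i) (L*Q≤σ i)
      (proj₂ (sizes i)) (lone-item≤L+excess i)

  cost-exchange : cost P + k * L S ≤ cost Q + (s' + ℓ') * L S + Σ excess
  cost-exchange = begin
    cost P + k * L S
      ≡⟨ cong (λ m → cost P + m * L S) (countL Q) ⟨
    cost P + Σ (b Q) * L S
      ≡⟨ cong (cost P +_) (Σ-*ʳ (b Q) (L S)) ⟨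
    cost P + Σ (λ i → b Q i * L S)
      ≡⟨ Σ-+ (λ i → charged (items i) (σ i)) (λ i → b Q i * L S) ⟨
    Σ (λ i → charged (items i) (σ i) + b Q i * L S)
      ≤⟨ Σ-mono charge-exchange-bin ⟩
    Σ (λ i → charged (a Q i + b Q i) (σ i) + items i * L S + excess i)
      ≡⟨ trans (Σ-+ _ excess) (cong (_+ Σ excess) (Σ-+ (λ i → charged (a Q i + b Q i) (σ i)) (λ i → items i * L S))) ⟩
    cost Q + Σ (λ i → items i * L S) + Σ excess
      ≡⟨ cong (λ m → cost Q + m + Σ excess) (trans (Σ-*ʳ items (L S)) (cong (_* L S) Σitems)) ⟩
    cost Q + (s' + ℓ') * L S + Σ excess ∎
    where
      open ≤-Reasoning
      Σitems : Σ items ≡ s' + ℓ'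
      Σitems = trans (Σ-+ (a P) (b P)) (cong₂ _+_ (countS P) (countL P))

  module _ (thrifty : Thrifty P) (front : ReasonableFront P) (valid : Valid Q)
           (balance : 2 * k ≡ s' + 2 * ℓ') where

    Q-before : ∀ {i l} → Overcharged i → 0 < b Q l → toℕ l < toℕ i
    Q-before {i} {l} (_ , noL , L<σ) 0<bQ with <-cmp (toℕ l) (toℕ i)
    ... | tri< l<i _ _ = l<i
    ... | tri≈ _ l≡i _ = ⊥-elim (n>0⇒n≢0 (subst (λ j → 0 < b Q j) (toℕ-injective l≡i) 0<bQ) noL)
    ... | tri> _ _ i<l = ⊥-elim (<-asym L<σ (valid i l (L S) (Q-noS i , noL) i<l (inj₂ (refl , 0<bQ))))

    P-occupies : ∀ {j l} → Overcharged j → toℕ l < toℕ j → L S ≤ σ l → Nonempty P l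
    P-occupies {j} {l} (lone , _) l<j L≤σ empty
      with single-item (a P j) (b P j) lone
    ... | inj₁ (a≡1 , _) = thrifty l (j , S , l<j , inj₁ (refl , ≡suc⇒0< a≡1) ,
                                       subst (S ≤_) (sym (space-empty P empty)) (≤-trans (S≤L 1≤S) L≤σ))
    ... | inj₂ (_ , b≡1) = thrifty l (j , L S , l<j , inj₂ (refl , ≡suc⇒0< b≡1) ,
                                       subst (L S ≤_) (sym (space-empty P empty)) L≤σ)

    lone-S-wasteful : ∀ {i j} → Overcharged i → toℕ i < toℕ j → a P i ≡ 1 → 0 < a P j → ⊥
    lone-S-wasteful {i} {j} (lone , _ , L<σ) i<j a≡1 0<aPj =
      thrifty i (j , S , i<j , inj₁ (refl , 0<aPj) , subst (S ≤_) (sym space≡σ∸S) (L<⇒S≤∸S L<σ))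
      where
        b≡0 : b P i ≡ 0
        b≡0 = +-cancelˡ-≡ 1 _ _ (trans (cong (_+ b P i) (sym a≡1)) lone)
        space≡σ∸S : space P i ≡ σ i ∸ S
        space≡σ∸S = cong (σ i ∸_)
          (trans (cong₂ (λ x y → x * S + y * L S) a≡1 b≡0) (trans (+-identityʳ _) (+-identityʳ S)))

    weight deficit surplus : Fin n → ℕ
    weight  i = a P i + b P i * 2
    deficit i = b Q i * 2 ∸ weight i
    surplus i = weight i ∸ b Q i * 2

    Σweight≡ΣQ : Σ weight ≡ Σ (λ i → b Q i * 2)
    Σweight≡ΣQ = begin
      Σ weight
        ≡⟨ Σ-+ (a P) (λ i → b P i * 2) ⟩
      Σ (a P) + Σ (λ i → b P i * 2)
        ≡⟨ cong₂ _+_ (countS P) (trans (Σ-*ʳ (b P) 2) (cong (_* 2) (countL P))) ⟩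
      s' + ℓ' * 2
        ≡⟨ trans (cong (s' +_) (*-comm ℓ' 2)) (trans (sym balance) (*-comm 2 k)) ⟩
      k * 2
        ≡⟨ trans (Σ-*ʳ (b Q) 2) (cong (_* 2) (countL Q)) ⟨
      Σ (λ i → b Q i * 2) ∎
      where open ≡-Reasoning

    overcharged-pair≤Σdeficit : ∀ {i j} → Overcharged i → Overcharged j → toℕ i < toℕ j →
      weight i + weight j ≤ Σ deficit
    overcharged-pair≤Σdeficit (_ , noLi , _) (_ , noLj , _) i<j =
      subst₂ _≤_ (cong₂ _+_ (surplus≡weight noLi) (surplus≡weight noLj))
                 (Σ-∸-balance weight (λ l → b Q l * 2) Σweight≡ΣQ) (Σ-pair surplus i<j)
      where
        surplus≡weight : ∀ {l} → b Q l ≡ 0 → surplus l ≡ weight l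
        surplus≡weight {l} noL = cong (λ y → weight l ∸ y * 2) noL

    deficit-lone-S : ∀ {j l} → Overcharged j → 0 < deficit l →
      b Q l ≡ 1 × (a P l ≡ 1 × b P l ≡ 0) × toℕ l < toℕ j
    deficit-lone-S {j} {l} oj 0<d with b Q l in bQ≡ | Q-L≤1 l
    ... | zero  | _ = ⊥-elim (n>0⇒n≢0 0<d (0∸n≡0 (weight l)))
    ... | suc (suc _) | s≤s ()
    ... | 1 | _ = refl , lone-S-weight (a P l) (b P l) (m∸n≢0⇒n<m (n>0⇒n≢0 0<d)) occupied , l<j
      where
        l<j : toℕ l < toℕ j
        l<j = Q-before oj (≡suc⇒0< bQ≡)
        occupied : Nonempty P l
        occupied = P-occupies oj l<j (Q-L⇒L≤σ bQ≡)

    lone-S-after-key : ∀ {κ l} → IsKeyBin P κ → a P l ≡ 1 → b P l ≡ 0 → L S ≤ σ l → toℕ κ < toℕ l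
    lone-S-after-key {κ} {l} key a≡1 b≡0 L≤σ = ≰⇒> λ l≤κ →
      <⇒≱ (lone-S-bin<L 1≤S (subst₂ (ReasonableBin S (σ l)) a≡1 b≡0 (front κ key l l≤κ occupied))) L≤σ
      where
        occupied : Nonempty P l
        occupied (a≡0 , _) = 1+n≢0 (trans (sym a≡1) a≡0)

    Σdeficit≤after-key : ∀ {κ j} → IsKeyBin P κ → Overcharged j → Σ deficit ≤ after κ (a P)
    Σdeficit≤after-key key oj = Σ≤after λ l 0<d →
      let bQ≡1 , (a≡1 , b≡0) , _ = deficit-lone-S oj 0<d in
      lone-S-after-key key a≡1 b≡0 (Q-L⇒L≤σ bQ≡1) ,
      ≤-reflexive (trans (cong₂ (λ q w → q * 2 ∸ w) bQ≡1 (cong₂ (λ x y → x + y * 2) a≡1 b≡0)) (sym a≡1))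

    3≤Σdeficit : ∀ {i j} → Overcharged i → Overcharged j → toℕ i < toℕ j → 3 ≤ Σ deficit
    3≤Σdeficit {i} {j} oi@(lone-i , _) oj@(lone-j , _) i<j =
      ≤-trans 3≤weights (overcharged-pair≤Σdeficit oi oj i<j)
      where
        3≤weights : 3 ≤ weight i + weight j
        3≤weights with single-item (a P i) (b P i) lone-i | single-item (a P j) (b P j) lone-j
        ... | inj₁ (ai , _)  | inj₁ (aj , _)  =
          ⊥-elim (lone-S-wasteful oi i<j ai (≡suc⇒0< aj))
        ... | inj₁ (ai , bi) | inj₂ (aj , bj) rewrite ai | bi | aj | bj = ≤-refl
        ... | inj₂ (ai , bi) | inj₁ (aj , bj) rewrite ai | bi | aj | bj = ≤-refl
        ... | inj₂ (ai , bi) | inj₂ (aj , bj) rewrite ai | bi | aj | bj = s≤s (s≤s (s≤s z≤n))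

    no-two-overcharged : ∀ {i j} → Overcharged i → Overcharged j → toℕ i < toℕ j → ⊥
    no-two-overcharged {i} {j} oi oj i<j with keyBin P i
    ... | κ , key@(inj₂ aP-after≤2 , _) =
      1+n≰n (≤-trans (3≤Σdeficit oi oj i<j) (≤-trans (Σdeficit≤after-key key oj) aP-after≤2))
    ... | κ , key@(inj₁ noL-after , _) =
      lone-S-wasteful oi i<j (lone-S-after oi κ<i) (≡suc⇒0< (lone-S-after oj (<-trans κ<i i<j)))
      where
        κ<i : toℕ κ < toℕ i
        κ<i =
          let l , 0<d = Σ>0⇒∃>0 deficit (≤-trans (s≤s z≤n) (3≤Σdeficit oi oj i<j))
              bQ≡1 , (a≡1 , b≡0) , l<i = deficit-lone-S oi 0<d
          in <-trans (lone-S-after-key key a≡1 b≡0 (Q-L⇒L≤σ bQ≡1)) l<i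
        lone-S-after : ∀ {l} → Overcharged l → toℕ κ < toℕ l → a P l ≡ 1
        lone-S-after {l} (lone , _) κ<l =
          trans (sym (+-identityʳ (a P l))) (trans (cong (a P l +_) (sym b≡0)) lone)
          where
            b≡0 : b P l ≡ 0
            b≡0 = n≤0⇒n≡0 (subst (b P l ≤_) noL-after (≤after κ<l))

    Σexcess≤M∸L : Σ excess ≤ M S ∸ L S
    Σexcess≤M∸L = Σ≤-support≤1 excess≤M∸L λ i<j 0<eᵢ 0<eⱼ →
      no-two-overcharged (excess>0⇒overcharged 0<eᵢ) (excess>0⇒overcharged 0<eⱼ) i<j

≤-shift-multiple : ∀ {c c' K N ℓ m} → K ≤ N → ℓ ≤ m →
  c + K * ℓ ≤ c' + N * ℓ + (m ∸ ℓ) → c + ℓ ≤ c' + (N ∸ K) * ℓ + m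
≤-shift-multiple {c} {c'} {K} {N} {ℓ} {m} K≤N ℓ≤m le
  with N ∸ K | m ∸ ℓ | m+[n∸m]≡n K≤N | m+[n∸m]≡n ℓ≤m
... | D | E | refl | refl =
  subst₂ _≤_ (+-comm ℓ c) (regroup₂ c' D E ℓ)
    (+-monoʳ-≤ ℓ (+-cancelˡ-≤ (K * ℓ) c _ (subst₂ _≤_ (+-comm c (K * ℓ)) (regroup₁ c' K D E ℓ) le)))
  where
    regroup₁ : ∀ c' K D E ℓ → c' + (K + D) * ℓ + E ≡ K * ℓ + (c' + D * ℓ + E)
    regroup₁ = solve-∀
    regroup₂ : ∀ c' D E ℓ → ℓ + (c' + D * ℓ + E) ≡ c' + D * ℓ + (ℓ + E)
    regroup₂ = solve-∀

k≤s'+ℓ' : ∀ {s' ℓ' k} → 2 * k ≡ s' + 2 * ℓ' → k ≤ s' + ℓ'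
k≤s'+ℓ' {s'} {ℓ'} {k} balance = *-cancelˡ-≤ 2 (begin
  2 * k            ≡⟨ balance ⟩
  s' + 2 * ℓ'      ≤⟨ +-monoˡ-≤ (2 * ℓ') (m≤n*m s' 2) ⟩
  2 * s' + 2 * ℓ'  ≡⟨ *-distribˡ-+ 2 s' ℓ' ⟨
  2 * (s' + ℓ')    ∎)
  where open ≤-Reasoning

lemma6 : (S : ℕ) → 1 < S → {n : ℕ} → (σ : Fin n → ℕ) → BinSizesOK S σ →
    (s' ℓ' k : ℕ) → 2 * k ≡ s' + 2 * ℓ' →
    (P : Packing S σ s' ℓ') → Reasonable P →
    (Q : Packing S σ 0 k) → Valid Q →
    cost P + L S ≤ cost Q + (s' + ℓ' ∸ k) * L S + M S
lemma6 S 1<S σ sizes s' ℓ' k balance P (thrifty , front) Q valid =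
  ≤-shift-multiple {c' = cost Q} (k≤s'+ℓ' {s'} {ℓ'} {k} balance) (L≤M S)
    (≤-trans cost-exchange (+-monoʳ-≤ _ (Σexcess≤M∸L thrifty front valid balance)))
  where open Accounting (<⇒≤ 1<S) sizes P Q
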